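{- Let $C$ be a neighbour-transitive code with minimum distance $\delta\geq 3$ in the Kneser graph $K(n,k)$ and suppose that $\mathrm{Aut}(C)$ acts transitively on $\Omega$. Then either $n=2k+1$ (i.e. $K(n,k)$ is an odd graph) or $\mathrm{Aut}(C)$ acts $2$-homogeneously on $\Omega$.
   Context: Let $\Omega$ be a finite set with $|\Omega|=n$ and let $2\leq k\leq (n-1)/2$. The Kneser graph $K(n,k)$ has as vertices the $k$-subsets of $\Omega$, two vertices being adjacent iff they are disjoint; when $n=2k+1$ it is the odd graph $O_{k+1}$. Its automorphism group is $\mathrm{Sym}(\Omega)$. A code $C$ is a set of vertices with $|C|\geq 2$. Writing $d$ for graph distance, the minimum distance $\delta$ of $C$ is the least distance between two distinct codewords; $C_1$ is the set of vertices $\gamma$ with $\min_{\alpha\in C} d(\alpha,\gamma)=1$. $\mathrm{Aut}(C)$ is the setwise stabiliser of $C$ in $\mathrm{Sym}(\Omega)$. $C$ is neighbour-transitive if $C_1\neq\emptyset$ and $\mathrm{Aut}(C)$ is transitive on both $C$ and $C_1$. A group acting on $\Omega$ is $2$-homogeneous if it is transitive on the set of $2$-subsets of $\Omega$. -}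

module Defs where

open import Data.Nat using (ℕ; zero; suc; _≤_)
open import Data.Bool using (Bool; true)
open import Data.Fin using (Fin)
open import Data.Fin.Subset using (Subset; _∩_; ∣_∣; Empty)
open import Data.Vec using (tabulate; lookup)
open import Data.Product using (Σ; ∃; _×_)
open import Data.Sum using (_⊎_)
open import Function.Bundles using (_↔_; Inverse)
open import Relation.Binary.PropositionalEquality using (_≡_; _≢_)
open import Relation.Nullary using (¬_)

-- Ω = Fin n ; vertices of K(n,k) are subsets s with ∣ s ∣ ≡ k.
module _ {n : ℕ} (k : ℕ) where

  IsVertex : Subset n → Set
  IsVertex s = ∣ s ∣ ≡ k

  Adj : Subset n → Subset n → Set
  Adj s t = Empty (s ∩ t)

  data Walk : Subset n → Subset n → ℕ → Set where
    here : ∀ {s} → Walk s s zero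
    step : ∀ {s u t m} → IsVertex u → Adj s u → Walk u t m → Walk s t (suc m)

  Dist : Subset n → Subset n → ℕ → Set
  Dist s t m = Walk s t m × (∀ m′ → Walk s t m′ → m ≤ m′)

  module _ (C : Subset n → Bool) where

    InC : Subset n → Set
    InC s = C s ≡ true

    IsCode : Set
    IsCode = (∀ s → InC s → IsVertex s)
           × Σ (Subset n) λ α → Σ (Subset n) λ β → InC α × InC β × α ≢ β

    MinDist : ℕ → Set
    MinDist δ =
      (Σ (Subset n) λ α → Σ (Subset n) λ β → InC α × InC β × α ≢ β × Dist α β δ)
      × (∀ α β m → InC α → InC β → α ≢ β → Dist α β m → δ ≤ m)

    DistToCode : Subset n → ℕ → Set
    DistToCode γ m =
      (Σ (Subset n) λ α → InC α × Dist α γ m)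
      × (∀ α m′ → InC α → Dist α γ m′ → m ≤ m′)

    InC₁ : Subset n → Set
    InC₁ γ = IsVertex γ × DistToCode γ 1

Perm : ℕ → Set
Perm n = Fin n ↔ Fin n

act : ∀ {n} → Perm n → Subset n → Subset n
act σ s = tabulate (λ i → lookup s (Inverse.from σ i))

InAut : ∀ {n} → (Subset n → Bool) → Perm n → Set
InAut {n} C σ = ∀ (s : Subset n) → C (act σ s) ≡ C s

module _ {n : ℕ} (k : ℕ) (C : Subset n → Bool) where

  NeighbourTransitive : Set
  NeighbourTransitive =
    (Σ (Subset n) λ γ → InC₁ k C γ)
    × (∀ α β → InC k C α → InC k C β → Σ (Perm n) λ σ → InAut C σ × act σ α ≡ β)
    × (∀ α β → InC₁ k C α → InC₁ k C β → Σ (Perm n) λ σ → InAut C σ × act σ α ≡ β)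

module _ {n : ℕ} (C : Subset n → Bool) where

  AutTransitiveOnΩ : Set
  AutTransitiveOnΩ = ∀ (i j : Fin n) → Σ (Perm n) λ σ → InAut C σ × Inverse.to σ i ≡ j

  AutTwoHomogeneous : Set
  AutTwoHomogeneous = ∀ (a b c d : Fin n) → a ≢ b → c ≢ d →
    Σ (Perm n) λ σ → InAut C σ ×
      ((Inverse.to σ a ≡ c × Inverse.to σ b ≡ d) ⊎ (Inverse.to σ a ≡ d × Inverse.to σ b ≡ c))

module Submission where

-- Let α be a codeword. Since δ ≥ 2, every k-set disjoint from α is a neighbour of α lying in C₁, so
-- neighbour-transitivity makes Aut(C) transitive on the k-subsets of Ω ∖ α. When n ≥ 2k + 2 this
-- region has at least k + 2 points, and then every Aut(C)-invariant graph γ on Ω is complete or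
-- empty on Ω ∖ α: the number of γ-edges inside a k-subset is invariant, and exchanging one point of a
-- k-subset for another shows that all points see any two others alike. If γ is empty on Ω ∖ α, then
-- α is a vertex cover with k points; γ is regular because Aut(C) is transitive on Ω, and counting the
-- edges leaving Ω ∖ α gives d (n − k) ≤ d k, whence d = 0 as n > 2k. Applying this to the orbital
-- graph of a pair {a, b} and to its complement shows that every 2-subset lies in the orbit of {a, b}.

open import Defs
open import Data.Bool using (Bool; true; false; not; _∧_; _∨_)
open import Data.Bool.Properties using (∧-zeroʳ; ∧-identityʳ; ∨-identityʳ; not-injective)
  renaming (_≟_ to _≟ᵇ_)
open import Data.Empty using (⊥; ⊥-elim)
open import Data.Fin using (Fin; zero; suc; punchIn; punchOut)
open import Data.Fin.Permutation
  using (_⟨$⟩ʳ_; _⟨$⟩ˡ_; inverseˡ; inverseʳ; flip; _∘ₚ_; _≈_; insert; remove; insert-remove)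
  renaming (id to idₚ)
open import Data.Fin.Properties using (_≟_; any?)
open import Data.Fin.Subset using (Subset; ∣_∣)
open import Data.Fin.Subset.Properties using (anySubset?; x∈p∩q⁺; x∈p∩q⁻)
open import Data.Nat using (ℕ; zero; suc; _+_; _*_; _≤_; _<_; z≤n; s≤s; s≤s⁻¹; >-nonZero)
open import Data.Nat.Properties
  using (+-*-semiring; +-identityʳ; +-comm; +-assoc; *-identityʳ; *-distribʳ-+; *-distribˡ-+; +-suc;
         +-mono-≤; ≤-refl; ≤-trans; ≤-reflexive; m≤m+n; m≤n+m; n≤1+n; 1+n≰n; ≤∧≢⇒<;
         +-cancelˡ-≡; +-cancelˡ-≤; 1+n≢0; *-comm; m+1+n≰m; <⇒≤; *-cancelˡ-≡; *-cancelˡ-≤)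
  renaming (_≟_ to _≟ℕ_)
open import Data.Product using (Σ; ∃; ∃₂; _×_; _,_; proj₁; proj₂)
open import Data.Sum using (_⊎_; inj₁; inj₂; [_,_]′)
open import Data.Vec using ([]; _∷_; lookup; tabulate)
open import Data.Vec.Properties using (lookup∘tabulate; tabulate∘lookup; tabulate-cong; lookup⇒[]=; []=⇒lookup)
open import Function using (_∘_; mk⇔)
open import Relation.Binary.PropositionalEquality
open import Relation.Nullary using (¬_; Dec; yes; no; does; contradiction; ¬?)
open import Relation.Nullary.Decidable using (map′; _×-dec_; _⊎-dec_; dec-true; dec-false; does-⇔; decidable-stable)

open import Algebra.Properties.Semiring.Sum +-*-semiring
  using (sum; sum-cong-≗; sum-replicate-zero; ∑-distrib-+; ∑-comm; sum-permute; *-distribˡ-sum)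

𝟙 : Bool → ℕ
𝟙 true  = 1
𝟙 false = 0

𝟙-gap : ∀ u v → 𝟙 u ≡ suc (𝟙 v) → u ≡ true × v ≡ false
𝟙-gap true false _ = refl , refl
𝟙-gap true true ()
𝟙-gap false _ ()

≤-sum : ∀ {n} (f : Fin n → ℕ) i → f i ≤ sum f
≤-sum f zero    = m≤m+n _ _
≤-sum f (suc i) = ≤-trans (≤-sum (f ∘ suc) i) (m≤n+m _ (f zero))

sum-mono-≤ : ∀ {n} {f g : Fin n → ℕ} → (∀ i → f i ≤ g i) → sum f ≤ sum g
sum-mono-≤ {zero}  _   = z≤n
sum-mono-≤ {suc n} f≤g = +-mono-≤ (f≤g zero) (sum-mono-≤ (f≤g ∘ suc))

sum-cong : ∀ {n} {f g : Fin n → ℕ} → (∀ i → f i ≡ g i) → sum f ≡ sum g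
sum-cong {n} = sum-cong-≗ {n}

sum-ones : ∀ n → sum {n} (λ _ → 1) ≡ n
sum-ones zero    = refl
sum-ones (suc n) = cong suc (sum-ones n)

sum-𝟙≟ : ∀ {n} (y : Fin n) (f : Fin n → ℕ) → sum (λ i → 𝟙 (does (i ≟ y)) * f i) ≡ f y
sum-𝟙≟ {suc n} zero    f = trans (cong₂ _+_ (+-identityʳ (f zero)) (sum-replicate-zero n)) (+-identityʳ (f zero))
sum-𝟙≟ {suc n} (suc y) f = sum-𝟙≟ y (f ∘ suc)

sum-𝟙≟-const : ∀ {n} (y : Fin n) → sum (λ i → 𝟙 (does (i ≟ y))) ≡ 1
sum-𝟙≟-const {n} y = trans (sum-cong {n} (λ i → sym (*-identityʳ (𝟙 (does (i ≟ y)))))) (sum-𝟙≟ y (λ _ → 1))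

sum-∘-⟨$⟩ˡ : ∀ {n} (f : Fin n → ℕ) (g : Perm n) → sum (f ∘ (g ⟨$⟩ˡ_)) ≡ sum f
sum-∘-⟨$⟩ˡ f g = sym (sum-permute f (flip g))

_⊆_ : ∀ {n} → (Fin n → Bool) → (Fin n → Bool) → Set
X ⊆ Y = ∀ i → X i ≡ true → Y i ≡ true

infix 4 _⊆_

card : ∀ {n} → (Fin n → Bool) → ℕ
card X = sum (𝟙 ∘ X)

∣p∣≡card : ∀ {n} (p : Subset n) → ∣ p ∣ ≡ card (lookup p)
∣p∣≡card []          = refl
∣p∣≡card (true ∷ p)  = cong suc (∣p∣≡card p)
∣p∣≡card (false ∷ p) = ∣p∣≡card p

card-tabulate : ∀ {n} (X : Fin n → Bool) → card (lookup (tabulate X)) ≡ card X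
card-tabulate X = sum-cong (cong 𝟙 ∘ lookup∘tabulate X)

card-∁ : ∀ {n} (X : Fin n → Bool) → card X + card (not ∘ X) ≡ n
card-∁ {n} X = begin
  card X + card (not ∘ X)                ≡⟨ ∑-distrib-+ (𝟙 ∘ X) (𝟙 ∘ not ∘ X) ⟨
  sum (λ i → 𝟙 (X i) + 𝟙 (not (X i)))    ≡⟨ sum-cong (𝟙-+-𝟙-not ∘ X) ⟩
  sum {n} (λ _ → 1)                      ≡⟨ sum-ones n ⟩
  n                                      ∎
  where
  open ≡-Reasoning
  𝟙-+-𝟙-not : ∀ b → 𝟙 b + 𝟙 (not b) ≡ 1
  𝟙-+-𝟙-not true  = refl
  𝟙-+-𝟙-not false = refl

card-positive : ∀ {n} (X : Fin n → Bool) → 1 ≤ card X → ∃ λ i → X i ≡ true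
card-positive {suc n} X h with X zero in X₀
... | true  = zero , X₀
... | false with card-positive (X ∘ suc) h
...   | i , Xi = suc i , Xi

subset-of-size : ∀ {n} (X : Fin n → Bool) j → j ≤ card X → ∃ λ S → S ⊆ X × card S ≡ j
subset-of-size {n} X zero _ = (λ _ → false) , (λ _ ()) , sum-replicate-zero n
subset-of-size {suc n} X (suc j) j<∣X∣ with X zero in X₀
... | true with subset-of-size (X ∘ suc) j (s≤s⁻¹ j<∣X∣)
...   | S , S⊆X , ∣S∣ = (λ { zero → true ; (suc i) → S i }) , (λ { zero _ → X₀ ; (suc i) → S⊆X i }) , cong suc ∣S∣
subset-of-size {suc n} X (suc j) j<∣X∣ | false with subset-of-size (X ∘ suc) (suc j) j<∣X∣
...   | S , S⊆X , ∣S∣ = (λ { zero → false ; (suc i) → S i }) , (λ { zero () ; (suc i) → S⊆X i }) , ∣S∣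

_∪⁅_⁆ : ∀ {n} → (Fin n → Bool) → Fin n → (Fin n → Bool)
(S ∪⁅ y ⁆) i = S i ∨ does (i ≟ y)

_─⁅_⁆ : ∀ {n} → (Fin n → Bool) → Fin n → (Fin n → Bool)
(S ─⁅ y ⁆) i = S i ∧ not (does (i ≟ y))

infixl 6 _∪⁅_⁆ _─⁅_⁆

module _ {n : ℕ} where

  ∈-∪⁅⁆⁻ : ∀ (S : Fin n → Bool) y i → (S ∪⁅ y ⁆) i ≡ true → S i ≡ true ⊎ i ≡ y
  ∈-∪⁅⁆⁻ S y i i∈ with i ≟ y
  ... | yes i≡y = inj₂ i≡y
  ... | no  _   = inj₁ (trans (sym (∨-identityʳ (S i))) i∈)

  ∪⁅⁆-⊆ : ∀ {S X : Fin n → Bool} {y} → S ⊆ X → X y ≡ true → S ∪⁅ y ⁆ ⊆ X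
  ∪⁅⁆-⊆ {S} {y = y} S⊆X Xy i i∈ with ∈-∪⁅⁆⁻ S y i i∈
  ... | inj₁ i∈S  = S⊆X i i∈S
  ... | inj₂ refl = Xy

  ∈-─⁅⁆⁻ : ∀ (S : Fin n → Bool) y i → (S ─⁅ y ⁆) i ≡ true → S i ≡ true × i ≢ y
  ∈-─⁅⁆⁻ S y i i∈ with i ≟ y
  ... | yes _   = contradiction (trans (sym (∧-zeroʳ (S i))) i∈) λ ()
  ... | no  i≢y = trans (sym (∧-identityʳ (S i))) i∈ , i≢y

  ∈-─⁅⁆⁺ : ∀ (S : Fin n → Bool) y i → S i ≡ true → i ≢ y → (S ─⁅ y ⁆) i ≡ true
  ∈-─⁅⁆⁺ S y i Si i≢y rewrite dec-false (i ≟ y) i≢y = trans (∧-identityʳ (S i)) Si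

  ⊆-trans : ∀ {X Y Z : Fin n → Bool} → X ⊆ Y → Y ⊆ Z → X ⊆ Z
  ⊆-trans X⊆Y Y⊆Z i = Y⊆Z i ∘ X⊆Y i

  ─⁅⁆-⊆ : ∀ (S : Fin n → Bool) y → S ─⁅ y ⁆ ⊆ S
  ─⁅⁆-⊆ S y i = proj₁ ∘ ∈-─⁅⁆⁻ S y i

  ⊆-─⁅⁆⇒∉ : ∀ {S X : Fin n → Bool} {y} → S ⊆ X ─⁅ y ⁆ → S y ≡ false
  ⊆-─⁅⁆⇒∉ {S} {X} {y} S⊆ with S y in Sy
  ... | false = refl
  ... | true  = contradiction refl (proj₂ (∈-─⁅⁆⁻ X y y (S⊆ y Sy)))

  𝟙-∪⁅⁆ : ∀ (S : Fin n → Bool) y → S y ≡ false → ∀ i → 𝟙 ((S ∪⁅ y ⁆) i) ≡ 𝟙 (S i) + 𝟙 (does (i ≟ y))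
  𝟙-∪⁅⁆ S y y∉S i with i ≟ y
  ... | yes refl rewrite y∉S = refl
  ... | no  _    rewrite ∨-identityʳ (S i) = sym (+-identityʳ _)

  card-∪⁅⁆ : ∀ (S : Fin n → Bool) y → S y ≡ false → card (S ∪⁅ y ⁆) ≡ suc (card S)
  card-∪⁅⁆ S y y∉S = begin
    card (S ∪⁅ y ⁆)                           ≡⟨ sum-cong (𝟙-∪⁅⁆ S y y∉S) ⟩
    sum (λ i → 𝟙 (S i) + 𝟙 (does (i ≟ y)))    ≡⟨ ∑-distrib-+ (𝟙 ∘ S) _ ⟩
    card S + sum (λ i → 𝟙 (does (i ≟ y)))     ≡⟨ cong (card S +_) (sum-𝟙≟-const y) ⟩
    card S + 1                                ≡⟨ +-comm (card S) 1 ⟩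
    suc (card S)                              ∎
    where open ≡-Reasoning

  sum-∪⁅⁆ : ∀ (S : Fin n → Bool) y → S y ≡ false → ∀ f →
    sum (λ i → 𝟙 ((S ∪⁅ y ⁆) i) * f i) ≡ sum (λ i → 𝟙 (S i) * f i) + f y
  sum-∪⁅⁆ S y y∉S f = begin
    sum (λ i → 𝟙 ((S ∪⁅ y ⁆) i) * f i)
      ≡⟨ sum-cong (λ i → trans (cong (_* f i) (𝟙-∪⁅⁆ S y y∉S i)) (*-distribʳ-+ (f i) (𝟙 (S i)) _)) ⟩
    sum (λ i → 𝟙 (S i) * f i + 𝟙 (does (i ≟ y)) * f i)
      ≡⟨ ∑-distrib-+ (λ i → 𝟙 (S i) * f i) _ ⟩
    sum (λ i → 𝟙 (S i) * f i) + sum (λ i → 𝟙 (does (i ≟ y)) * f i)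
      ≡⟨ cong (sum (λ i → 𝟙 (S i) * f i) +_) (sum-𝟙≟ y f) ⟩
    sum (λ i → 𝟙 (S i) * f i) + f y
      ∎
    where open ≡-Reasoning

  card-─⁅⁆ : ∀ (S : Fin n → Bool) y → card S ≤ suc (card (S ─⁅ y ⁆))
  card-─⁅⁆ S y = begin
    card S                                              ≤⟨ sum-mono-≤ 𝟙-─⁅⁆ ⟩
    sum (λ i → 𝟙 ((S ─⁅ y ⁆) i) + 𝟙 (does (i ≟ y)))     ≡⟨ ∑-distrib-+ (𝟙 ∘ (S ─⁅ y ⁆)) _ ⟩
    card (S ─⁅ y ⁆) + sum (λ i → 𝟙 (does (i ≟ y)))      ≡⟨ cong (card (S ─⁅ y ⁆) +_) (sum-𝟙≟-const y) ⟩
    card (S ─⁅ y ⁆) + 1                                 ≡⟨ +-comm _ 1 ⟩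
    suc (card (S ─⁅ y ⁆))                               ∎
    where
    open Data.Nat.Properties.≤-Reasoning
    𝟙-─⁅⁆ : ∀ i → 𝟙 (S i) ≤ 𝟙 ((S ─⁅ y ⁆) i) + 𝟙 (does (i ≟ y))
    𝟙-─⁅⁆ i with i ≟ y | S i
    ... | yes _ | true  = ≤-refl
    ... | yes _ | false = z≤n
    ... | no  _ | b     rewrite ∧-identityʳ b = m≤m+n _ _

  card-─⁅⁆-≥ : ∀ {j} (S : Fin n → Bool) y → suc j ≤ card S → j ≤ card (S ─⁅ y ⁆)
  card-─⁅⁆-≥ S y j<∣S∣ = s≤s⁻¹ (≤-trans j<∣S∣ (card-─⁅⁆ S y))

  two-points : ∀ (X : Fin n → Bool) → 2 ≤ card X → ∃₂ λ p q → X p ≡ true × X q ≡ true × p ≢ q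
  two-points X 2≤∣X∣ with card-positive X (≤-trans (s≤s z≤n) 2≤∣X∣)
  ... | p , Xp with card-positive (X ─⁅ p ⁆) (card-─⁅⁆-≥ X p 2≤∣X∣)
  ...   | q , q∈ = p , q , Xp , proj₁ (∈-─⁅⁆⁻ X p q q∈) , proj₂ (∈-─⁅⁆⁻ X p q q∈) ∘ sym

⟨$⟩ʳ-injective : ∀ {n} (σ : Perm n) {x y} → σ ⟨$⟩ʳ x ≡ σ ⟨$⟩ʳ y → x ≡ y
⟨$⟩ʳ-injective σ σx≡σy = trans (sym (inverseˡ σ)) (trans (cong (σ ⟨$⟩ˡ_) σx≡σy) (inverseˡ σ))

module _ {n : ℕ} where

  lookup-act : ∀ (σ : Perm n) s i → lookup (act σ s) i ≡ lookup s (σ ⟨$⟩ˡ i)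
  lookup-act σ s = lookup∘tabulate _

  act-∘ₚ : ∀ (σ τ : Perm n) s → act (σ ∘ₚ τ) s ≡ act τ (act σ s)
  act-∘ₚ σ τ s = tabulate-cong (λ i → sym (lookup-act σ s (τ ⟨$⟩ˡ i)))

  act-flip : ∀ (σ : Perm n) s → act σ (act (flip σ) s) ≡ s
  act-flip σ s = trans (tabulate-cong λ i → trans (lookup-act (flip σ) s _) (cong (lookup s) (inverseʳ σ)))
                       (tabulate∘lookup s)

  act-cong : ∀ (σ τ : Perm n) → σ ≈ τ → ∀ s → act σ s ≡ act τ s
  act-cong σ τ σ≈τ s = tabulate-cong (λ i → cong (lookup s) (⟨$⟩ˡ-cong i))
    where
    ⟨$⟩ˡ-cong : ∀ i → σ ⟨$⟩ˡ i ≡ τ ⟨$⟩ˡ i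
    ⟨$⟩ˡ-cong i = ⟨$⟩ʳ-injective τ (trans (sym (σ≈τ (σ ⟨$⟩ˡ i))) (trans (inverseʳ σ) (sym (inverseʳ τ))))

  act-tabulate : ∀ (σ : Perm n) {A B : Fin n → Bool} → act σ (tabulate A) ≡ tabulate B → B ≗ A ∘ (σ ⟨$⟩ˡ_)
  act-tabulate σ {A} {B} σA≡B i = begin
    B i                             ≡⟨ lookup∘tabulate B i ⟨
    lookup (tabulate B) i           ≡⟨ cong (λ s → lookup s i) σA≡B ⟨
    lookup (act σ (tabulate A)) i   ≡⟨ lookup-act σ (tabulate A) i ⟩
    lookup (tabulate A) (σ ⟨$⟩ˡ i)  ≡⟨ lookup∘tabulate A (σ ⟨$⟩ˡ i) ⟩
    A (σ ⟨$⟩ˡ i)                    ∎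
    where open ≡-Reasoning

  module _ (C : Subset n → Bool) where

    InAut-id : InAut C idₚ
    InAut-id s = cong C (tabulate∘lookup s)

    InAut-∘ₚ : ∀ σ τ → InAut C σ → InAut C τ → InAut C (σ ∘ₚ τ)
    InAut-∘ₚ σ τ σ∈ τ∈ s = trans (cong C (act-∘ₚ σ τ s)) (trans (τ∈ (act σ s)) (σ∈ s))

    InAut-flip : ∀ σ → InAut C σ → InAut C (flip σ)
    InAut-flip σ σ∈ s = trans (sym (σ∈ (act (flip σ) s))) (cong C (act-flip σ s))

    InAut-cong : ∀ σ τ → σ ≈ τ → InAut C σ → InAut C τ
    InAut-cong σ τ σ≈τ σ∈ s = trans (cong C (sym (act-cong σ τ σ≈τ s))) (σ∈ s)

all-subsets? : ∀ {n} {P : Subset n → Set} → (∀ s → Dec (P s)) → Dec (∀ s → P s)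
all-subsets? P? = map′ (λ ¬∃¬P s → decidable-stable (P? s) (λ ¬Ps → ¬∃¬P (s , ¬Ps)))
                       (λ ∀P (s , ¬Ps) → ¬Ps (∀P s))
                       (¬? (anySubset? (¬? ∘ P?)))

InAut? : ∀ {n} (C : Subset n → Bool) σ → Dec (InAut C σ)
InAut? C σ = all-subsets? (λ s → C (act σ s) ≟ᵇ C s)

insert-cong : ∀ {n} i j {σ τ : Perm n} → σ ≈ τ → insert i j σ ≈ insert i j τ
insert-cong i j σ≈τ k with i ≟ k
... | yes _   = refl
... | no  i≢k = cong (punchIn j) (σ≈τ (punchOut i≢k))

any-perm? : ∀ n (Q : Perm n → Set) → (∀ σ τ → σ ≈ τ → Q σ → Q τ) → (∀ σ → Dec (Q σ)) → Dec (Σ (Perm n) Q)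
any-perm? zero    Q respects-≈ Q? = map′ (idₚ ,_) (λ (σ , q) → respects-≈ _ _ (λ ()) q) (Q? idₚ)
any-perm? (suc n) Q respects-≈ Q? =
  map′ (λ (j , τ , q) → insert zero j τ , q)
       (λ (σ , q) → σ ⟨$⟩ʳ zero , remove zero σ , respects-≈ _ _ (sym ∘ insert-remove zero σ) q)
       (any? λ j → any-perm? n (Q ∘ insert zero j) (λ σ τ → respects-≈ _ _ ∘ insert-cong zero j) (Q? ∘ insert zero j))

Graph : ℕ → Set
Graph n = Fin n → Fin n → Bool

IsGraphAut : ∀ {n} → Graph n → Perm n → Set
IsGraphAut γ g = ∀ x y → γ (g ⟨$⟩ʳ x) (g ⟨$⟩ʳ y) ≡ γ x y

module _ {A : Set} where

  SamePair : A → A → A → A → Set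
  SamePair u v x y = (u ≡ x × v ≡ y) ⊎ (u ≡ y × v ≡ x)

  SamePair-swap : ∀ {u v x y} → SamePair u v x y → SamePair u v y x
  SamePair-swap (inj₁ u,v≡x,y) = inj₂ u,v≡x,y
  SamePair-swap (inj₂ u,v≡y,x) = inj₁ u,v≡y,x

  SamePair-diagonal : ∀ {u v x} → SamePair u v x x → u ≡ v
  SamePair-diagonal (inj₁ (u≡x , v≡x)) = trans u≡x (sym v≡x)
  SamePair-diagonal (inj₂ (u≡x , v≡x)) = trans u≡x (sym v≡x)

  SamePair-map : ∀ (f : A → A) {u v x y} → SamePair u v x y → SamePair (f u) (f v) (f x) (f y)
  SamePair-map f (inj₁ (u≡x , v≡y)) = inj₁ (cong f u≡x , cong f v≡y)
  SamePair-map f (inj₂ (u≡y , v≡x)) = inj₂ (cong f u≡y , cong f v≡x)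

-- OrbitalEdge is decided by exhaustive search over Perm n, which makes the orbital graph Bool-valued.
module Orbital {n : ℕ} (C : Subset n → Bool) (a b : Fin n) (a≢b : a ≢ b) where

  OrbitalEdge : Fin n → Fin n → Set
  OrbitalEdge x y = Σ (Perm n) λ σ → InAut C σ × SamePair (σ ⟨$⟩ʳ a) (σ ⟨$⟩ʳ b) x y

  orbitalEdge? : ∀ x y → Dec (OrbitalEdge x y)
  orbitalEdge? x y = any-perm? n (λ σ → InAut C σ × SamePair (σ ⟨$⟩ʳ a) (σ ⟨$⟩ʳ b) x y) respects-≈
    λ σ → InAut? C σ ×-dec (((σ ⟨$⟩ʳ a ≟ x) ×-dec (σ ⟨$⟩ʳ b ≟ y)) ⊎-dec ((σ ⟨$⟩ʳ a ≟ y) ×-dec (σ ⟨$⟩ʳ b ≟ x)))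
    where
    respects-≈ : ∀ σ τ → σ ≈ τ → InAut C σ × SamePair (σ ⟨$⟩ʳ a) (σ ⟨$⟩ʳ b) x y →
                                 InAut C τ × SamePair (τ ⟨$⟩ʳ a) (τ ⟨$⟩ʳ b) x y
    respects-≈ σ τ σ≈τ (σ∈ , same) =
      InAut-cong C σ τ σ≈τ σ∈ , subst₂ (λ u v → SamePair u v x y) (σ≈τ a) (σ≈τ b) same

  orbital : Graph n
  orbital x y = does (orbitalEdge? x y)

  orbital-witness : ∀ x y → orbital x y ≡ true → OrbitalEdge x y
  orbital-witness x y _  with orbitalEdge? x y
  orbital-witness x y _  | yes e = e
  orbital-witness x y () | no  _

  orbital-ab : orbital a b ≡ true
  orbital-ab = dec-true (orbitalEdge? a b) (idₚ , InAut-id C , inj₁ (refl , refl))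

  orbital-sym : ∀ x y → orbital x y ≡ orbital y x
  orbital-sym x y = does-⇔ (mk⇔ swap swap) (orbitalEdge? x y) (orbitalEdge? y x)
    where
    swap : ∀ {x y} → OrbitalEdge x y → OrbitalEdge y x
    swap (σ , σ∈ , same) = σ , σ∈ , SamePair-swap same

  orbital-irrefl : ∀ x → orbital x x ≡ false
  orbital-irrefl x = dec-false (orbitalEdge? x x) λ (σ , _ , same) → a≢b (⟨$⟩ʳ-injective σ (SamePair-diagonal same))

  OrbitalEdge-image : ∀ g → InAut C g → ∀ {x y} → OrbitalEdge x y → OrbitalEdge (g ⟨$⟩ʳ x) (g ⟨$⟩ʳ y)
  OrbitalEdge-image g g∈ (σ , σ∈ , same) = σ ∘ₚ g , InAut-∘ₚ C σ g σ∈ g∈ , SamePair-map (g ⟨$⟩ʳ_) same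

  orbital-invariant : ∀ g → InAut C g → IsGraphAut orbital g
  orbital-invariant g g∈ x y =
    does-⇔ (mk⇔ preimage (OrbitalEdge-image g g∈)) (orbitalEdge? (g ⟨$⟩ʳ x) (g ⟨$⟩ʳ y)) (orbitalEdge? x y)
    where
    preimage : OrbitalEdge (g ⟨$⟩ʳ x) (g ⟨$⟩ʳ y) → OrbitalEdge x y
    preimage e = subst₂ OrbitalEdge (inverseˡ g) (inverseˡ g) (OrbitalEdge-image (flip g) (InAut-flip C g g∈) e)

module _ {n k : ℕ} where

  walk-length-zero : ∀ {s t : Subset n} → Walk k s t 0 → s ≡ t
  walk-length-zero here = refl

  vertex-nonempty : ∀ {s : Subset n} → IsVertex k s → 1 ≤ k → ∃ λ i → lookup s i ≡ true
  vertex-nonempty {s} ∣s∣≡k 1≤k = card-positive (lookup s) (subst (1 ≤_) (trans (sym ∣s∣≡k) (∣p∣≡card s)) 1≤k)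

  Adj-irrefl : ∀ {s : Subset n} → IsVertex k s → 1 ≤ k → ¬ Adj k s s
  Adj-irrefl {s} vs 1≤k s∩s≡∅ with vertex-nonempty {s} vs 1≤k
  ... | i , si = s∩s≡∅ (i , x∈p∩q⁺ (lookup⇒[]= i s si , lookup⇒[]= i s si))

  dist-adjacent : ∀ {s t : Subset n} → IsVertex k s → IsVertex k t → 1 ≤ k → Adj k s t → Dist k s t 1
  dist-adjacent {s} vs vt 1≤k s~t = step vt s~t here , λ where
    zero    w → contradiction (subst (Adj k s) (sym (walk-length-zero w)) s~t) (Adj-irrefl vs 1≤k)
    (suc _) _ → s≤s z≤n

  disjoint⇒Adj : ∀ (α : Subset n) (A : Fin n → Bool) → A ⊆ not ∘ lookup α → Adj k α (tabulate A)
  disjoint⇒Adj α A A⊆∁α (i , i∈α∩A) with x∈p∩q⁻ α (tabulate A) i∈α∩A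
  ... | i∈α , i∈A = contradiction (subst (λ b → not b ≡ true) ([]=⇒lookup i∈α) i∉α) λ ()
    where
    i∉α : not (lookup α i) ≡ true
    i∉α = A⊆∁α i (trans (sym (lookup∘tabulate A i)) ([]=⇒lookup i∈A))

  module _ (C : Subset n → Bool) (isCode : IsCode k C) {δ : ℕ} (minDist : MinDist k C δ) (2≤δ : 2 ≤ δ)
    (1≤k : 1 ≤ k) where

    neighbour-∈C₁ : ∀ {α γ} → InC k C α → IsVertex k γ → Adj k α γ → InC₁ k C γ
    neighbour-∈C₁ {α} {γ} α∈C vγ α~γ = vγ , (α , α∈C , dist-αγ) , nearest
      where
      vα : IsVertex k α
      vα = proj₁ isCode α α∈C
      dist-αγ : Dist k α γ 1
      dist-αγ = dist-adjacent vα vγ 1≤k α~γ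
      α≢γ : α ≢ γ
      α≢γ α≡γ = Adj-irrefl vα 1≤k (subst (Adj k α) (sym α≡γ) α~γ)
      nearest : ∀ β m → InC k C β → Dist k β γ m → 1 ≤ m
      nearest β zero    β∈C (w , _) with walk-length-zero w
      ... | refl = contradiction (≤-trans 2≤δ (proj₂ minDist α β 1 α∈C β∈C α≢γ dist-αγ)) 1+n≰n
      nearest β (suc m) _   _       = s≤s z≤n

    Aut-transitive-on-disjoint-k-sets : NeighbourTransitive k C → ∀ {α} → InC k C α →
      ∀ A B → A ⊆ not ∘ lookup α → B ⊆ not ∘ lookup α → card A ≡ k → card B ≡ k →
      Σ (Perm n) λ g → InAut C g × B ≗ A ∘ (g ⟨$⟩ˡ_)
    Aut-transitive-on-disjoint-k-sets (_ , _ , C₁-transitive) {α} α∈C A B A⊆∁α B⊆∁α ∣A∣ ∣B∣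
      with C₁-transitive (tabulate A) (tabulate B) (∈C₁ A A⊆∁α ∣A∣) (∈C₁ B B⊆∁α ∣B∣)
      where
      ∈C₁ : ∀ X → X ⊆ not ∘ lookup α → card X ≡ k → InC₁ k C (tabulate X)
      ∈C₁ X X⊆∁α ∣X∣ = neighbour-∈C₁ α∈C (trans (∣p∣≡card (tabulate X)) (trans (card-tabulate X) ∣X∣))
                                      (disjoint⇒Adj α X X⊆∁α)
    ... | g , g∈ , gA≡B = g , g∈ , act-tabulate g gA≡B

module Degrees {n : ℕ} (γ : Graph n) (γ-sym : ∀ x y → γ x y ≡ γ y x) (γ-irrefl : ∀ x → γ x x ≡ false) where

  deg : (Fin n → Bool) → Fin n → ℕ
  deg S x = sum λ y → 𝟙 (S y) * 𝟙 (γ x y)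

  degreeSum : (Fin n → Bool) → ℕ
  degreeSum S = sum λ x → 𝟙 (S x) * deg S x

  deg-∪⁅⁆ : ∀ S y → S y ≡ false → ∀ x → deg (S ∪⁅ y ⁆) x ≡ deg S x + 𝟙 (γ x y)
  deg-∪⁅⁆ S y y∉S x = sum-∪⁅⁆ S y y∉S (𝟙 ∘ γ x)

  degreeSum-∪⁅⁆ : ∀ S y → S y ≡ false → degreeSum (S ∪⁅ y ⁆) ≡ degreeSum S + 2 * deg S y
  degreeSum-∪⁅⁆ S y y∉S = begin
    degreeSum (S ∪⁅ y ⁆)
      ≡⟨ sum-∪⁅⁆ S y y∉S (deg (S ∪⁅ y ⁆)) ⟩
    sum (λ x → 𝟙 (S x) * deg (S ∪⁅ y ⁆) x) + deg (S ∪⁅ y ⁆) y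
      ≡⟨ cong₂ _+_ (sum-cong λ x → cong (𝟙 (S x) *_) (deg-∪⁅⁆ S y y∉S x)) (deg-∪⁅⁆ S y y∉S y) ⟩
    sum (λ x → 𝟙 (S x) * (deg S x + 𝟙 (γ x y))) + (deg S y + 𝟙 (γ y y))
      ≡⟨ cong₂ _+_ (sum-cong λ x → *-distribˡ-+ (𝟙 (S x)) (deg S x) _) (cong (λ b → deg S y + 𝟙 b) (γ-irrefl y)) ⟩
    sum (λ x → 𝟙 (S x) * deg S x + 𝟙 (S x) * 𝟙 (γ x y)) + (deg S y + 0)
      ≡⟨ cong (_+ (deg S y + 0)) (∑-distrib-+ (λ x → 𝟙 (S x) * deg S x) _) ⟩
    degreeSum S + sum (λ x → 𝟙 (S x) * 𝟙 (γ x y)) + (deg S y + 0)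
      ≡⟨ cong (λ d → degreeSum S + d + (deg S y + 0)) (sum-cong λ x → cong (λ b → 𝟙 (S x) * 𝟙 b) (γ-sym x y)) ⟩
    degreeSum S + deg S y + (deg S y + 0)
      ≡⟨ +-assoc (degreeSum S) (deg S y) _ ⟩
    degreeSum S + 2 * deg S y
      ∎
    where open ≡-Reasoning

  deg-transport : ∀ g → IsGraphAut γ g → ∀ A B → B ≗ A ∘ (g ⟨$⟩ˡ_) → ∀ x → deg B x ≡ deg A (g ⟨$⟩ˡ x)
  deg-transport g g-aut A B B≗gA x = begin
    sum (λ y → 𝟙 (B y) * 𝟙 (γ x y))
      ≡⟨ sum-cong (λ y → cong₂ (λ u v → 𝟙 u * 𝟙 v) (B≗gA y) (γ-⟨$⟩ˡ y)) ⟩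
    sum (λ y → 𝟙 (A (g ⟨$⟩ˡ y)) * 𝟙 (γ (g ⟨$⟩ˡ x) (g ⟨$⟩ˡ y)))
      ≡⟨ sum-∘-⟨$⟩ˡ (λ y → 𝟙 (A y) * 𝟙 (γ (g ⟨$⟩ˡ x) y)) g ⟩
    deg A (g ⟨$⟩ˡ x)
      ∎
    where
    open ≡-Reasoning
    γ-⟨$⟩ˡ : ∀ y → γ x y ≡ γ (g ⟨$⟩ˡ x) (g ⟨$⟩ˡ y)
    γ-⟨$⟩ˡ y = trans (sym (cong₂ γ (inverseʳ g) (inverseʳ g))) (g-aut _ _)

  degreeSum-transport : ∀ g → IsGraphAut γ g → ∀ A B → B ≗ A ∘ (g ⟨$⟩ˡ_) → degreeSum B ≡ degreeSum A
  degreeSum-transport g g-aut A B B≗gA = begin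
    sum (λ x → 𝟙 (B x) * deg B x)
      ≡⟨ sum-cong (λ x → cong₂ _*_ (cong 𝟙 (B≗gA x)) (deg-transport g g-aut A B B≗gA x)) ⟩
    sum (λ x → 𝟙 (A (g ⟨$⟩ˡ x)) * deg A (g ⟨$⟩ˡ x))
      ≡⟨ sum-∘-⟨$⟩ˡ (λ x → 𝟙 (A x) * deg A x) g ⟩
    degreeSum A
      ∎
    where open ≡-Reasoning

  deg-≡-card : ∀ S x → (∀ y → S y ≡ true → γ y x ≡ true) → deg S x ≡ card S
  deg-≡-card S x S⊆N[x] = sum-cong term
    where
    term : ∀ y → 𝟙 (S y) * 𝟙 (γ x y) ≡ 𝟙 (S y)
    term y with S y in Sy
    ... | false = refl
    ... | true  rewrite γ-sym x y | S⊆N[x] y Sy = refl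

  deg-≡-0 : ∀ S x → (∀ y → S y ≡ true → γ y x ≡ false) → deg S x ≡ 0
  deg-≡-0 S x S∩N[x]≡∅ = trans (sum-cong term) (sum-replicate-zero n)
    where
    term : ∀ y → 𝟙 (S y) * 𝟙 (γ x y) ≡ 0
    term y with S y in Sy
    ... | false = refl
    ... | true  rewrite γ-sym x y | S∩N[x]≡∅ y Sy = refl

module ConstantOnLargeRegion {n : ℕ} (G : Perm n → Set)
  (γ : Graph n) (γ-sym : ∀ x y → γ x y ≡ γ y x) (γ-irrefl : ∀ x → γ x x ≡ false)
  (γ-invariant : ∀ g → G g → IsGraphAut γ g)
  (m : ℕ) (W : Fin n → Bool) (W-large : 4 + m ≤ card W)
  (G-homogeneous : ∀ A B → A ⊆ W → B ⊆ W → card A ≡ 2 + m → card B ≡ 2 + m →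
                   Σ (Perm n) λ g → G g × B ≗ A ∘ (g ⟨$⟩ˡ_))
  where

  open Degrees γ γ-sym γ-irrefl

  degreeSum-constant : ∀ A B → A ⊆ W → B ⊆ W → card A ≡ 2 + m → card B ≡ 2 + m → degreeSum A ≡ degreeSum B
  degreeSum-constant A B A⊆W B⊆W ∣A∣ ∣B∣ with G-homogeneous A B A⊆W B⊆W ∣A∣ ∣B∣
  ... | g , g∈G , B≗gA = sym (degreeSum-transport g (γ-invariant g g∈G) A B B≗gA)

  U : Fin n → Fin n → Fin n → Bool
  U y z = W ─⁅ y ⁆ ─⁅ z ⁆

  card-U : ∀ y z → 2 + m ≤ card (U y z)
  card-U y z = card-─⁅⁆-≥ (W ─⁅ y ⁆) z (card-─⁅⁆-≥ W y W-large)

  U⊆W─⁅⁆ : ∀ y z → U y z ⊆ W ─⁅ y ⁆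
  U⊆W─⁅⁆ y z = ─⁅⁆-⊆ (W ─⁅ y ⁆) z

  ∈U⁺ : ∀ {x y z} → W x ≡ true → x ≢ y → x ≢ z → U y z x ≡ true
  ∈U⁺ {x} {y} {z} Wx x≢y x≢z = ∈-─⁅⁆⁺ (W ─⁅ y ⁆) z x (∈-─⁅⁆⁺ W y x Wx x≢y) x≢z

  deg-balanced : ∀ {y z} → W y ≡ true → W z ≡ true →
    ∀ S → S ⊆ U y z → card S ≡ 1 + m → deg S y ≡ deg S z
  deg-balanced {y} {z} Wy Wz S S⊆U ∣S∣ = *-cancelˡ-≡ _ _ 2 (+-cancelˡ-≡ (degreeSum S) _ _ (begin
    degreeSum S + 2 * deg S y  ≡⟨ degreeSum-∪⁅⁆ S y y∉S ⟨
    degreeSum (S ∪⁅ y ⁆)       ≡⟨ degreeSum-constant _ _ (∪⁅⁆-⊆ S⊆W Wy) (∪⁅⁆-⊆ S⊆W Wz) (∣S∪⁅⁆∣ y∉S) (∣S∪⁅⁆∣ z∉S) ⟩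
    degreeSum (S ∪⁅ z ⁆)       ≡⟨ degreeSum-∪⁅⁆ S z z∉S ⟩
    degreeSum S + 2 * deg S z  ∎))
    where
    open ≡-Reasoning
    S⊆W : S ⊆ W
    S⊆W = ⊆-trans S⊆U (⊆-trans (U⊆W─⁅⁆ y z) (─⁅⁆-⊆ W y))
    y∉S : S y ≡ false
    y∉S = ⊆-─⁅⁆⇒∉ {X = W} (⊆-trans S⊆U (U⊆W─⁅⁆ y z))
    z∉S : S z ≡ false
    z∉S = ⊆-─⁅⁆⇒∉ {X = W ─⁅ y ⁆} S⊆U
    ∣S∪⁅⁆∣ : ∀ {t} → S t ≡ false → card (S ∪⁅ t ⁆) ≡ 2 + m
    ∣S∪⁅⁆∣ {t} t∉S = trans (card-∪⁅⁆ S t t∉S) (cong suc ∣S∣)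

  neighbour-pattern-spreads : ∀ {x y z w} → W y ≡ true → W z ≡ true →
    U y z x ≡ true → U y z w ≡ true →
    γ x y ≡ true → γ x z ≡ false → γ w y ≡ true × γ w z ≡ false
  neighbour-pattern-spreads {x} {y} {z} {w} Wy Wz x∈U w∈U xy xz
    with subset-of-size (U y z ─⁅ x ⁆ ─⁅ w ⁆) m (card-─⁅⁆-≥ _ w (card-─⁅⁆-≥ (U y z) x (card-U y z)))
  -- For t ∈ {x, w}, deg-balanced on T ∪⁅ t ⁆ gives 𝟙 (γ t y) + deg T y = 𝟙 (γ t z) + deg T z.
  ... | T , T⊆ , ∣T∣ = 𝟙-gap (γ w y) (γ w z) (+-cancelˡ-≡ (deg T y) _ _ (begin
    deg T y + 𝟙 (γ w y)        ≡⟨ balanced w∈U w∉T ⟩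
    deg T z + 𝟙 (γ w z)        ≡⟨ cong (_+ 𝟙 (γ w z)) balanced-at-x ⟨
    deg T y + 1 + 𝟙 (γ w z)    ≡⟨ +-assoc (deg T y) 1 _ ⟩
    deg T y + suc (𝟙 (γ w z))  ∎))
    where
    open ≡-Reasoning
    T⊆U─⁅x⁆ : T ⊆ U y z ─⁅ x ⁆
    T⊆U─⁅x⁆ = ⊆-trans T⊆ (─⁅⁆-⊆ _ w)
    x∉T : T x ≡ false
    x∉T = ⊆-─⁅⁆⇒∉ {X = U y z} T⊆U─⁅x⁆
    w∉T : T w ≡ false
    w∉T = ⊆-─⁅⁆⇒∉ {X = U y z ─⁅ x ⁆} T⊆
    balanced : ∀ {t} → U y z t ≡ true → T t ≡ false → deg T y + 𝟙 (γ t y) ≡ deg T z + 𝟙 (γ t z)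
    balanced {t} t∈U t∉T = begin
      deg T y + 𝟙 (γ t y)  ≡⟨ cong (λ b → deg T y + 𝟙 b) (γ-sym t y) ⟩
      deg T y + 𝟙 (γ y t)  ≡⟨ deg-∪⁅⁆ T t t∉T y ⟨
      deg (T ∪⁅ t ⁆) y      ≡⟨ deg-balanced Wy Wz (T ∪⁅ t ⁆) (∪⁅⁆-⊆ (⊆-trans T⊆U─⁅x⁆ (─⁅⁆-⊆ _ x)) t∈U)
                                (trans (card-∪⁅⁆ T t t∉T) (cong suc ∣T∣)) ⟩
      deg (T ∪⁅ t ⁆) z      ≡⟨ deg-∪⁅⁆ T t t∉T z ⟩
      deg T z + 𝟙 (γ z t)  ≡⟨ cong (λ b → deg T z + 𝟙 b) (γ-sym z t) ⟩
      deg T z + 𝟙 (γ t z)  ∎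
    balanced-at-x : deg T y + 1 ≡ deg T z
    balanced-at-x = begin
      deg T y + 1          ≡⟨ cong (λ b → deg T y + 𝟙 b) xy ⟨
      deg T y + 𝟙 (γ x y)  ≡⟨ balanced x∈U x∉T ⟩
      deg T z + 𝟙 (γ x z)  ≡⟨ cong (λ b → deg T z + 𝟙 b) xz ⟩
      deg T z + 0          ≡⟨ +-identityʳ _ ⟩
      deg T z              ∎

  no-separating-vertex : ∀ {x y z} → W y ≡ true → W z ≡ true → U y z x ≡ true →
    γ x y ≡ true → γ x z ≡ false → ⊥
  no-separating-vertex {x} {y} {z} Wy Wz x∈U xy xz
    with subset-of-size (U y z ─⁅ x ⁆) m (≤-trans (n≤1+n m) (card-─⁅⁆-≥ (U y z) x (card-U y z)))
  ... | T , T⊆ , ∣T∣ = 1+n≢0 (begin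
    suc m    ≡⟨ ∣S∣ ⟨
    card S   ≡⟨ deg-≡-card S y (λ j → proj₁ ∘ shared-pattern j) ⟨
    deg S y  ≡⟨ deg-balanced Wy Wz S S⊆U ∣S∣ ⟩
    deg S z  ≡⟨ deg-≡-0 S z (λ j → proj₂ ∘ shared-pattern j) ⟩
    0        ∎)
    where
    open ≡-Reasoning
    S : Fin n → Bool
    S = T ∪⁅ x ⁆
    x∉T : T x ≡ false
    x∉T = ⊆-─⁅⁆⇒∉ {X = U y z} T⊆
    S⊆U : S ⊆ U y z
    S⊆U = ∪⁅⁆-⊆ (⊆-trans T⊆ (─⁅⁆-⊆ (U y z) x)) x∈U
    ∣S∣ : card S ≡ 1 + m
    ∣S∣ = trans (card-∪⁅⁆ T x x∉T) (cong suc ∣T∣)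
    shared-pattern : ∀ j → S j ≡ true → γ j y ≡ true × γ j z ≡ false
    shared-pattern j j∈S with ∈-∪⁅⁆⁻ T x j j∈S
    ... | inj₂ refl = xy , xz
    ... | inj₁ j∈T with ∈-─⁅⁆⁻ (U y z) x j (T⊆ j j∈T)
    ...   | j∈U , _ = neighbour-pattern-spreads Wy Wz x∈U j∈U xy xz

  star-constant : ∀ {x y z} → W x ≡ true → W y ≡ true → W z ≡ true → x ≢ y → x ≢ z → γ x y ≡ γ x z
  star-constant {x} {y} {z} Wx Wy Wz x≢y x≢z with γ x y in xy | γ x z in xz
  ... | true  | true  = refl
  ... | false | false = refl
  ... | true  | false = ⊥-elim (no-separating-vertex Wy Wz (∈U⁺ Wx x≢y x≢z) xy xz)
  ... | false | true  = ⊥-elim (no-separating-vertex Wz Wy (∈U⁺ Wx x≢z x≢y) xz xy)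

  constant-on-region : ∀ {x y u v} → W x ≡ true → W y ≡ true → W u ≡ true → W v ≡ true →
    x ≢ y → u ≢ v → γ x y ≡ γ u v
  constant-on-region {x} {y} {u} {v} Wx Wy Wu Wv x≢y u≢v with v ≟ x
  ... | yes refl = trans (star-constant Wx Wy Wu x≢y (u≢v ∘ sym)) (γ-sym x u)
  ... | no  v≢x  = begin
    γ x y  ≡⟨ star-constant Wx Wy Wv x≢y (v≢x ∘ sym) ⟩
    γ x v  ≡⟨ γ-sym x v ⟩
    γ v x  ≡⟨ star-constant Wv Wx Wu v≢x (u≢v ∘ sym) ⟩
    γ v u  ≡⟨ γ-sym v u ⟩
    γ u v  ∎
    where open ≡-Reasoning

module SmallVertexCover {n : ℕ} (G : Perm n → Set)
  (G-transitive : ∀ i j → Σ (Perm n) λ g → G g × g ⟨$⟩ʳ i ≡ j)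
  (γ : Graph n) (γ-sym : ∀ x y → γ x y ≡ γ y x) (γ-irrefl : ∀ x → γ x x ≡ false)
  (γ-invariant : ∀ g → G g → IsGraphAut γ g)
  where

  degree : Fin n → ℕ
  degree x = sum λ y → 𝟙 (γ x y)

  degree-invariant : ∀ g → G g → ∀ x → degree (g ⟨$⟩ʳ x) ≡ degree x
  degree-invariant g g∈G x = trans (sum-permute (𝟙 ∘ γ (g ⟨$⟩ʳ x)) g) (sum-cong (cong 𝟙 ∘ γ-invariant g g∈G x))

  degree-constant : ∀ x y → degree x ≡ degree y
  degree-constant x y with G-transitive x y
  ... | g , g∈G , gx≡y = trans (sym (degree-invariant g g∈G x)) (cong degree gx≡y)

  degree-weighted-card : ∀ (X : Fin n → Bool) z → sum (λ x → 𝟙 (X x) * degree x) ≡ degree z * card X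
  degree-weighted-card X z =
    trans (sum-cong λ x → trans (cong (𝟙 (X x) *_) (degree-constant x z)) (*-comm (𝟙 (X x)) (degree z)))
          (sym (*-distribˡ-sum (degree z) (𝟙 ∘ X)))

  IsVertexCover : (Fin n → Bool) → Set
  IsVertexCover β = ∀ x y → β x ≡ false → β y ≡ false → x ≢ y → γ x y ≡ false

  outside-degrees-≤-inside : ∀ β → IsVertexCover β →
    sum (λ y → 𝟙 (not (β y)) * degree y) ≤ sum (λ x → 𝟙 (β x) * degree x)
  outside-degrees-≤-inside β cover = begin
    sum (λ y → 𝟙 (not (β y)) * degree y)
      ≡⟨ sum-cong (λ y → *-distribˡ-sum (𝟙 (not (β y))) (𝟙 ∘ γ y)) ⟩
    sum (λ y → sum λ x → 𝟙 (not (β y)) * 𝟙 (γ y x))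
      ≤⟨ sum-mono-≤ (λ y → sum-mono-≤ (edge-counted-at-cover y)) ⟩
    sum (λ y → sum λ x → 𝟙 (β x) * 𝟙 (γ x y))
      ≡⟨ ∑-comm (λ y x → 𝟙 (β x) * 𝟙 (γ x y)) ⟩
    sum (λ x → sum λ y → 𝟙 (β x) * 𝟙 (γ x y))
      ≡⟨ sum-cong (λ x → *-distribˡ-sum (𝟙 (β x)) (𝟙 ∘ γ x)) ⟨
    sum (λ x → 𝟙 (β x) * degree x)
      ∎
    where
    open Data.Nat.Properties.≤-Reasoning
    edge-counted-at-cover : ∀ y x → 𝟙 (not (β y)) * 𝟙 (γ y x) ≤ 𝟙 (β x) * 𝟙 (γ x y)
    edge-counted-at-cover y x with β y in βy | β x in βx
    ... | true  | _    = z≤n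
    ... | false | true rewrite γ-sym y x = ≤-refl
    ... | false | false with y ≟ x
    ...   | yes refl rewrite γ-irrefl y = z≤n
    ...   | no  y≢x  rewrite cover y x βy βx y≢x = z≤n

  edgeless-of-small-cover : ∀ k β → card β ≡ k → 2 * k + 1 ≤ n → IsVertexCover β → ∀ a b → γ a b ≡ false
  edgeless-of-small-cover k β ∣β∣ 2k+1≤n cover a b with γ a b in ab
  ... | false = refl
  ... | true  = contradiction (≤-trans 2k+1≤n n≤2k) (m+1+n≰m (2 * k))
    where
    open Data.Nat.Properties.≤-Reasoning
    1≤degree : 1 ≤ degree a
    1≤degree = subst (_≤ degree a) (cong 𝟙 ab) (≤-sum (𝟙 ∘ γ a) b)
    ∣∁β∣≤k : card (not ∘ β) ≤ k
    ∣∁β∣≤k = *-cancelˡ-≤ (degree a) {{>-nonZero 1≤degree}} (begin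
      degree a * card (not ∘ β)               ≡⟨ degree-weighted-card (not ∘ β) a ⟨
      sum (λ y → 𝟙 (not (β y)) * degree y)   ≤⟨ outside-degrees-≤-inside β cover ⟩
      sum (λ x → 𝟙 (β x) * degree x)         ≡⟨ degree-weighted-card β a ⟩
      degree a * card β                       ≡⟨ cong (degree a *_) ∣β∣ ⟩
      degree a * k                            ∎)
    n≤2k : n ≤ 2 * k
    n≤2k = begin
      n                        ≡⟨ card-∁ β ⟨
      card β + card (not ∘ β)  ≤⟨ +-mono-≤ (≤-reflexive ∣β∣) ∣∁β∣≤k ⟩
      k + k                    ≡⟨ cong (k +_) (+-identityʳ k) ⟨
      2 * k                    ∎

_ᶜ : ∀ {n} → Graph n → Graph n
(γ ᶜ) x y = not (γ x y) ∧ not (does (x ≟ y))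

module _ {n : ℕ} (γ : Graph n) where

  ᶜ-sym : (∀ x y → γ x y ≡ γ y x) → ∀ x y → (γ ᶜ) x y ≡ (γ ᶜ) y x
  ᶜ-sym γ-sym x y = cong₂ (λ u v → not u ∧ not v) (γ-sym x y) (does-⇔ (mk⇔ sym sym) (x ≟ y) (y ≟ x))

  ᶜ-irrefl : ∀ x → (γ ᶜ) x x ≡ false
  ᶜ-irrefl x rewrite dec-true (x ≟ x) refl = ∧-zeroʳ _

  ᶜ-distinct : ∀ {x y} → x ≢ y → (γ ᶜ) x y ≡ not (γ x y)
  ᶜ-distinct {x} {y} x≢y rewrite dec-false (x ≟ y) x≢y = ∧-identityʳ _

  ᶜ-aut : ∀ g → IsGraphAut γ g → IsGraphAut (γ ᶜ) g
  ᶜ-aut g g-aut x y = cong₂ (λ u v → not u ∧ not v) (g-aut x y)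
    (does-⇔ (mk⇔ (⟨$⟩ʳ-injective g) (cong (g ⟨$⟩ʳ_))) (g ⟨$⟩ʳ x ≟ g ⟨$⟩ʳ y) (x ≟ y))

module InvariantGraphs {n : ℕ} (G : Perm n → Set)
  (G-transitive : ∀ i j → Σ (Perm n) λ g → G g × g ⟨$⟩ʳ i ≡ j)
  (m : ℕ) (α : Fin n → Bool) (∣α∣ : card α ≡ 2 + m) (n-large : 2 * (2 + m) + 1 < n)
  (G-homogeneous : ∀ A B → A ⊆ not ∘ α → B ⊆ not ∘ α → card A ≡ 2 + m → card B ≡ 2 + m →
                   Σ (Perm n) λ g → G g × B ≗ A ∘ (g ⟨$⟩ˡ_))
  where

  ∁α-large : 4 + m ≤ card (not ∘ α)
  ∁α-large = +-cancelˡ-≤ (2 + m) _ _ (begin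
    (2 + m) + (4 + m)         ≡⟨ arith (2 + m) ⟩
    suc (2 * (2 + m) + 1)     ≤⟨ n-large ⟩
    n                         ≡⟨ card-∁ α ⟨
    card α + card (not ∘ α)   ≡⟨ cong (_+ card (not ∘ α)) ∣α∣ ⟩
    (2 + m) + card (not ∘ α)  ∎)
    where
    open Data.Nat.Properties.≤-Reasoning
    arith : ∀ k → k + (2 + k) ≡ suc (2 * k + 1)
    arith k = begin-equality
      k + (2 + k)          ≡⟨ +-suc k (suc k) ⟩
      suc (k + suc k)      ≡⟨ cong suc (+-suc k k) ⟩
      suc (suc (k + k))    ≡⟨ cong (λ j → suc (suc (k + j))) (+-identityʳ k) ⟨
      suc (suc (2 * k))    ≡⟨ cong suc (+-comm 1 (2 * k)) ⟩
      suc (2 * k + 1)      ∎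

  two-points-off-α : ∃₂ λ p q → α p ≡ false × α q ≡ false × p ≢ q
  two-points-off-α =
    let p , q , p∉α , q∉α , p≢q = two-points (not ∘ α) (≤-trans (s≤s (s≤s z≤n)) ∁α-large)
    in p , q , not-injective p∉α , not-injective q∉α , p≢q

  edgeless-if-edgeless-off-α : ∀ (γ : Graph n) → (∀ x y → γ x y ≡ γ y x) → (∀ x → γ x x ≡ false) →
    (∀ g → G g → IsGraphAut γ g) →
    (∀ x y → α x ≡ false → α y ≡ false → x ≢ y → γ x y ≡ false) → ∀ x y → γ x y ≡ false
  edgeless-if-edgeless-off-α γ γ-sym γ-irrefl γ-invariant =
    SmallVertexCover.edgeless-of-small-cover G G-transitive γ γ-sym γ-irrefl γ-invariant (2 + m) α ∣α∣ (<⇒≤ n-large)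

  module _ (γ : Graph n) (γ-sym : ∀ x y → γ x y ≡ γ y x) (γ-irrefl : ∀ x → γ x x ≡ false)
    (γ-invariant : ∀ g → G g → IsGraphAut γ g) where

    constant-off-α : ∀ {x y u v} → α x ≡ false → α y ≡ false → α u ≡ false → α v ≡ false →
      x ≢ y → u ≢ v → γ x y ≡ γ u v
    constant-off-α x∉α y∉α u∉α v∉α = constant-on-region (cong not x∉α) (cong not y∉α) (cong not u∉α) (cong not v∉α)
      where open ConstantOnLargeRegion G γ γ-sym γ-irrefl γ-invariant m (not ∘ α) ∁α-large G-homogeneous

    complete-or-empty-from : ∀ {p q} → α p ≡ false → α q ≡ false → p ≢ q →
      (∀ x y → γ x y ≡ false) ⊎ (∀ x y → x ≢ y → γ x y ≡ true)
    complete-or-empty-from {p} {q} p∉α q∉α p≢q with γ p q in pq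
    ... | false = inj₁ (edgeless-if-edgeless-off-α γ γ-sym γ-irrefl γ-invariant λ x y x∉α y∉α x≢y →
                    trans (constant-off-α x∉α y∉α p∉α q∉α x≢y p≢q) pq)
    ... | true  = inj₂ λ x y x≢y → not-injective (trans (sym (ᶜ-distinct γ x≢y)) (∁γ-edgeless x y))
      where
      ∁γ-edgeless : ∀ x y → (γ ᶜ) x y ≡ false
      ∁γ-edgeless = edgeless-if-edgeless-off-α (γ ᶜ) (ᶜ-sym γ γ-sym) (ᶜ-irrefl γ)
        (λ g g∈G → ᶜ-aut γ g (γ-invariant g g∈G)) λ x y x∉α y∉α x≢y →
        trans (ᶜ-distinct γ x≢y) (cong not (trans (constant-off-α x∉α y∉α p∉α q∉α x≢y p≢q) pq))

    complete-or-empty : (∀ x y → γ x y ≡ false) ⊎ (∀ x y → x ≢ y → γ x y ≡ true)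
    complete-or-empty = let _ , _ , p∉α , q∉α , p≢q = two-points-off-α in complete-or-empty-from p∉α q∉α p≢q

-- δ ≥ 2 suffices: it is only used to place the neighbours of a codeword in C₁.
Aut-2-homogeneous : ∀ {n k} → 2 ≤ k → 2 * k + 1 < n → (C : Subset n → Bool) → IsCode k C → NeighbourTransitive k C →
  ∀ {δ} → MinDist k C δ → 2 ≤ δ → AutTransitiveOnΩ C → AutTwoHomogeneous C
Aut-2-homogeneous (s≤s (s≤s {n = m} z≤n)) n-large C isCode@(_ , α , _ , α∈C , _) nt minDist 2≤δ Ω-transitive
                  a b c d a≢b c≢d =
  [ (λ empty → contradiction (trans (sym orbital-ab) (empty a b)) λ ())
  , (λ complete → orbital-witness c d (complete c d c≢d))
  ]′ (complete-or-empty orbital orbital-sym orbital-irrefl orbital-invariant)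
  where
  ∣α∣ : card (lookup α) ≡ 2 + m
  ∣α∣ = trans (sym (∣p∣≡card α)) (proj₁ isCode α α∈C)
  open Orbital C a b a≢b
  open InvariantGraphs (InAut C) Ω-transitive m (lookup α) ∣α∣ n-large
         (Aut-transitive-on-disjoint-k-sets C isCode minDist 2≤δ (s≤s z≤n) nt α∈C)

theorem1p4 : (n k : ℕ) → 2 ≤ k → 2 * k + 1 ≤ n →
    (C : Subset n → Bool) → IsCode k C → NeighbourTransitive k C →
    (δ : ℕ) → MinDist k C δ → 3 ≤ δ →
    AutTransitiveOnΩ C →
    (n ≡ 2 * k + 1) ⊎ AutTwoHomogeneous C
theorem1p4 n k 2≤k 2k+1≤n C isCode nt δ minDist 3≤δ Ω-transitive with n ≟ℕ 2 * k + 1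
... | yes n≡2k+1 = inj₁ n≡2k+1
... | no  n≢2k+1 = inj₂ (Aut-2-homogeneous 2≤k (≤∧≢⇒< 2k+1≤n (n≢2k+1 ∘ sym)) C isCode nt minDist
                                            (≤-trans (n≤1+n 2) 3≤δ) Ω-transitive)
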